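{- Let $M$ be a spike with legs $l_1=\{a_1,b_1\},\dots,l_n=\{a_n,b_n\}$, and let $\mathcal{T}(M)$ be the set of all transversals of $(l_1,\dots,l_n)$ that are dependent in $M$. If $T_1,T_2\in\mathcal{T}(M)$, then $|T_1-T_2|\neq 1$.
   Context: Let $n\ge 3$. Let $N$ be a rank-$n$ matroid with ground set $\{t,a_1,b_1,\dots,a_n,b_n\}$ such that (i) $\{t,a_i,b_i\}$ is a triangle for every $i$, and (ii) $r(\bigcup_{j\in J}\{a_j,b_j\})=|J|+1$ for every nonempty proper subset $J$ of $\{1,\dots,n\}$. Then $M=N\setminus t$ is a rank-$n$ spike with legs $\{a_i,b_i\}$. A transversal of $(l_1,\dots,l_n)$ is a set containing exactly one element of each $l_i$. -}

module Defs where

open import Data.Nat using (ℕ; zero; suc; _+_; _≤_; _<_)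
open import Data.Fin using (Fin; _↑ˡ_; _↑ʳ_)
import Data.Fin as F
open import Data.Fin.Subset
  using (Subset; inside; outside; _∈_; _∉_; _⊆_; _⊂_; _∪_; _∩_; ⁅_⁆; ∣_∣; Nonempty; ⊤)
open import Data.Vec using (_∷_; _++_)
open import Data.Product using (Σ; _×_; ∃)
open import Data.Sum using (_⊎_)
open import Relation.Binary.PropositionalEquality using (_≡_; _≢_)

record Matroid (m : ℕ) : Set where
  field
    r      : Subset m → ℕ
    r-card : ∀ X → r X ≤ ∣ X ∣
    r-mono : ∀ {X Y} → X ⊆ Y → r X ≤ r Y
    r-sub  : ∀ X Y → r (X ∪ Y) + r (X ∩ Y) ≤ r X + r Y

open Matroid public

Independent : ∀ {m} → Matroid m → Subset m → Set
Independent M X = r M X ≡ ∣ X ∣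

Dependent : ∀ {m} → Matroid m → Subset m → Set
Dependent M X = r M X < ∣ X ∣

Circuit : ∀ {m} → Matroid m → Subset m → Set
Circuit M X = Dependent M X × (∀ Y → Y ⊂ X → Independent M Y)

Triangle : ∀ {m} → Matroid m → Subset m → Set
Triangle M X = Circuit M X × ∣ X ∣ ≡ 3

-- Ground set of M (rank-n spike): Fin (n + n), with
--   a_i = i ↑ˡ n   (positions 0 .. n-1)
--   b_i = n ↑ʳ i   (positions n .. 2n-1)
a : ∀ {n} → Fin n → Fin (n + n)
a {n} i = i ↑ˡ n

b : ∀ {n} → Fin n → Fin (n + n)
b {n} i = n ↑ʳ i

-- Ground set of N: Fin (suc (n + n)), with t = zero and the other
-- elements shifted by one (N \ t is obtained by dropping position zero).
tN : ∀ {n} → Fin (suc (n + n))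
tN = F.zero

aN : ∀ {n} → Fin n → Fin (suc (n + n))
aN {n} i = F.suc (a {n} i)

bN : ∀ {n} → Fin n → Fin (suc (n + n))
bN {n} i = F.suc (b {n} i)

tri : ∀ {n} → Fin n → Subset (suc (n + n))
tri {n} i = ⁅ tN {n} ⁆ ∪ ⁅ aN {n} i ⁆ ∪ ⁅ bN {n} i ⁆

-- ⋃_{j ∈ J} {a_j, b_j} as a subset of the ground set of N
-- (t is outside; a_j is in iff j ∈ J, b_j is in iff j ∈ J)
legsUnion : ∀ {n} → Subset n → Subset (suc (n + n))
legsUnion J = outside ∷ (J ++ J)

-- M is a rank-n spike with legs {a_i, b_i}: there is a rank-n matroid N
-- on {t, a_1, b_1, ..., a_n, b_n} satisfying (i) and (ii) with M = N \ t
-- (deletion: r_M(X) = r_N(X) for X avoiding t).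
IsSpike : (n : ℕ) → Matroid (n + n) → Set
IsSpike n M =
  Σ (Matroid (suc (n + n))) λ N →
      (r N ⊤ ≡ n)
    × (∀ (i : Fin n) → Triangle N (tri {n} i))
    × (∀ (J : Subset n) → Nonempty J → J ≢ ⊤ → r N (legsUnion J) ≡ suc ∣ J ∣)
    × (∀ (X : Subset (n + n)) → r M X ≡ r N (outside ∷ X))

-- T is a transversal of the legs (l_1, ..., l_n), l_i = {a_i, b_i}:
-- contains exactly one element of each l_i (and nothing else; the ground
-- set of M is exactly the union of the legs).
Transversal : ∀ n → Subset (n + n) → Set
Transversal n T =
  ∀ (i : Fin n) → (a {n} i ∈ T × b {n} i ∉ T) ⊎ (a {n} i ∉ T × b {n} i ∈ T)

module Submission where

-- If |T₁ ─ T₂| = 1, the two transversals agree on every leg except one, l_i, and T₁ ∪ T₂ ⊇ l_i.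
-- In N the tip t and any point of a leg span that leg's triangle, so (T₁ ∩ T₂) ∪ {t} spans every
-- leg other than l_i and has rank ≥ n by (ii); as l_i spans t, also r(T₁ ∪ T₂) ≥ n. Hence
-- r(T₁ ∪ T₂) + r(T₁ ∩ T₂) ≥ 2n − 1, while dependence and submodularity bound it by 2n − 2.

open import Defs
open import Data.Nat using (ℕ; suc; _≤_; _<_; _+_; _∸_; s≤s)
open import Data.Nat.Properties
  using (≤-trans; ≤-reflexive; ≤-pred; <⇒≤; 1+n≰n; >⇒≢; m≤m+n; +-suc; +-comm; +-mono-≤; +-monoʳ-≤; +-monoˡ-≤;
         +-cancelʳ-≤; m+[n∸m]≡n; module ≤-Reasoning)
open import Data.Fin as F using (Fin; _↑ˡ_; _↑ʳ_; splitAt; punchIn)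
open import Data.Fin.Properties
  using (↑ˡ-injective; ↑ʳ-injective; splitAt-↑ˡ; splitAt-↑ʳ; splitAt⁻¹-↑ˡ; splitAt⁻¹-↑ʳ;
         suc-injective; punchInᵢ≢i)
open import Data.Fin.Subset
  using (Subset; inside; outside; _∈_; _∉_; _⊆_; _⊂_; _∪_; _∩_; _─_; _-_; ⁅_⁆; ∣_∣; ∁; ⊤; Nonempty)
open import Data.Fin.Subset.Properties
open import Data.Fin.Subset.Induction using (⊂-wellFounded)
open import Data.Vec.Base using ([]; _∷_; _++_; here; there)
import Data.Vec.Base as Vec
open import Data.Vec.Properties using (lookup-++ˡ; lookup-++ʳ; []=⇒lookup; lookup⇒[]=)
open import Data.Product using (_×_; _,_; proj₁; proj₂; ∃-syntax)
open import Data.Sum using (_⊎_; inj₁; inj₂; [_,_]′)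
open import Data.Empty using (⊥-elim)
open import Function using (id; _∘_)
open import Induction.WellFounded using (Acc; acc)
open import Relation.Nullary using (yes; no; contradiction)
open import Relation.Binary.PropositionalEquality
  using (_≡_; _≢_; refl; sym; trans; cong; subst; ≢-sym)

∪-lub : ∀ {m} {p q s : Subset m} → p ⊆ s → q ⊆ s → p ∪ q ⊆ s
∪-lub {p = p} {q} p⊆s q⊆s x∈p∪q = [ p⊆s , q⊆s ]′ (x∈p∪q⁻ p q x∈p∪q)

x∈p⇒⁅x⁆⊆p : ∀ {m} {p : Subset m} {x} → x ∈ p → ⁅ x ⁆ ⊆ p
x∈p⇒⁅x⁆⊆p {p = p} {x} x∈p y∈⁅x⁆ = subst (_∈ p) (sym (x∈⁅y⁆⇒x≡y x y∈⁅x⁆)) x∈p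

x∈p─q⇒x∉q : ∀ {m} (p q : Subset m) {x} → x ∈ p ─ q → x ∉ q
x∈p─q⇒x∉q (_ ∷ p)      (_ ∷ q)       (there x∈p─q) = x∈p─q⇒x∉q p q x∈p─q ∘ drop-there
x∈p─q⇒x∉q (inside ∷ p) (outside ∷ q) here          = λ ()

x∈p∧y∈p∧x≢y⇒2≤∣p∣ : ∀ {m} {p : Subset m} {x y} → x ∈ p → y ∈ p → x ≢ y → 2 ≤ ∣ p ∣
x∈p∧y∈p∧x≢y⇒2≤∣p∣ {p = p} {x} x∈p y∈p x≢y =
  subst (_< ∣ p ∣) (∣⁅x⁆∣≡1 x)
    (p⊂q⇒∣p∣<∣q∣ (x∈p⇒⁅x⁆⊆p x∈p , _ , y∈p , x≢y ∘ sym ∘ x∈⁅y⁆⇒x≡y x))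

∣p∣≤1∧x∈p∧y∈p⇒x≡y : ∀ {m} {p : Subset m} {x y} → ∣ p ∣ ≤ 1 → x ∈ p → y ∈ p → x ≡ y
∣p∣≤1∧x∈p∧y∈p⇒x≡y {x = x} {y} ∣p∣≤1 x∈p y∈p with x F.≟ y
... | yes x≡y = x≡y
... | no x≢y = contradiction (≤-trans (x∈p∧y∈p∧x≢y⇒2≤∣p∣ x∈p y∈p x≢y) ∣p∣≤1) 1+n≰n

0<∣p∣⇒Nonempty : ∀ {m} {p : Subset m} → 0 < ∣ p ∣ → Nonempty p
0<∣p∣⇒Nonempty {m} {p} 0<∣p∣ with nonempty? p
... | yes p≠∅ = p≠∅
... | no p-empty = contradiction (trans (cong ∣_∣ (Empty-unique p-empty)) (∣⊥∣≡0 m)) (>⇒≢ 0<∣p∣)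

∣p++q∣≡∣p∣+∣q∣ : ∀ {k l} (p : Subset k) (q : Subset l) → ∣ p ++ q ∣ ≡ ∣ p ∣ + ∣ q ∣
∣p++q∣≡∣p∣+∣q∣ []            q = refl
∣p++q∣≡∣p∣+∣q∣ (inside  ∷ p) q = cong suc (∣p++q∣≡∣p∣+∣q∣ p q)
∣p++q∣≡∣p∣+∣q∣ (outside ∷ p) q = ∣p++q∣≡∣p∣+∣q∣ p q

module _ {k l} (p : Subset k) (q : Subset l) where

  x∈p⇒x↑ˡ∈p++q : ∀ {i} → i ∈ p → i ↑ˡ l ∈ p ++ q
  x∈p⇒x↑ˡ∈p++q {i} i∈p = lookup⇒[]= (i ↑ˡ l) (p ++ q) (trans (lookup-++ˡ p q i) ([]=⇒lookup i∈p))

  x↑ˡ∈p++q⇒x∈p : ∀ {i} → i ↑ˡ l ∈ p ++ q → i ∈ p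
  x↑ˡ∈p++q⇒x∈p {i} i∈ = lookup⇒[]= i p (trans (sym (lookup-++ˡ p q i)) ([]=⇒lookup i∈))

  x∈q⇒x↑ʳ∈p++q : ∀ {j} → j ∈ q → k ↑ʳ j ∈ p ++ q
  x∈q⇒x↑ʳ∈p++q {j} j∈q = lookup⇒[]= (k ↑ʳ j) (p ++ q) (trans (lookup-++ʳ p q j) ([]=⇒lookup j∈q))

  x↑ʳ∈p++q⇒x∈q : ∀ {j} → k ↑ʳ j ∈ p ++ q → j ∈ q
  x↑ʳ∈p++q⇒x∈q {j} j∈ = lookup⇒[]= j q (trans (sym (lookup-++ʳ p q j)) ([]=⇒lookup j∈))

↑ˡ≢↑ʳ : ∀ {m n} (i : Fin m) (j : Fin n) → i ↑ˡ n ≢ m ↑ʳ j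
↑ˡ≢↑ʳ {m} {n} i j eq
  with () ← trans (sym (splitAt-↑ˡ m i n)) (trans (cong (splitAt m) eq) (splitAt-↑ʳ m n j))

1+∣∁⁅x⁆∣≡n : ∀ {n} (i : Fin n) → suc ∣ ∁ ⁅ i ⁆ ∣ ≡ n
1+∣∁⁅x⁆∣≡n {suc n} i = cong suc (trans (∣∁p∣≡n∸∣p∣ ⁅ i ⁆) (cong (suc n ∸_) (∣⁅x⁆∣≡1 i)))

∁⁅x⁆-nonempty : ∀ {n} → 2 ≤ n → (i : Fin n) → Nonempty (∁ ⁅ i ⁆)
∁⁅x⁆-nonempty (s≤s (s≤s _)) i = punchIn i F.zero , x∉p⇒x∈∁p (x≢y⇒x∉⁅y⁆ (punchInᵢ≢i i F.zero))

∁⁅x⁆≢⊤ : ∀ {n} (i : Fin n) → ∁ ⁅ i ⁆ ≢ ⊤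
∁⁅x⁆≢⊤ i eq = x∈p⇒x∉∁p (x∈⁅x⁆ i) (subst (i ∈_) (sym eq) ∈⊤)

module _ {m} (M : Matroid m) where
  open ≤-Reasoning

  -- E ⊆ cl(X)
  Spans : Subset m → Subset m → Set
  Spans X E = r M (X ∪ E) ≤ r M X

  r-∪-≤ : ∀ X Y → r M (X ∪ Y) ≤ r M X + r M Y
  r-∪-≤ X Y = ≤-trans (m≤m+n _ _) (r-sub M X Y)

  dependent-∪-∩-bound : ∀ {X Y} → Dependent M X → Dependent M Y →
                        2 + (r M (X ∪ Y) + r M (X ∩ Y)) ≤ ∣ X ∣ + ∣ Y ∣
  dependent-∪-∩-bound {X} {Y} X-dep Y-dep = begin
    2 + (r M (X ∪ Y) + r M (X ∩ Y)) ≤⟨ s≤s (s≤s (r-sub M X Y)) ⟩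
    2 + (r M X + r M Y)             ≡⟨ cong suc (+-suc (r M X) (r M Y)) ⟨
    suc (r M X) + suc (r M Y)       ≤⟨ +-mono-≤ X-dep Y-dep ⟩
    ∣ X ∣ + ∣ Y ∣                   ∎

  ⊆⇒spans : ∀ {X E} → E ⊆ X → Spans X E
  ⊆⇒spans E⊆X = r-mono M (∪-lub id E⊆X)

  spans⇒r≤ : ∀ {X E} → Spans X E → r M E ≤ r M X
  spans⇒r≤ {X} {E} X↝E = ≤-trans (r-mono M (q⊆p∪q X E)) X↝E

  spans-monoʳ : ∀ {X E F} → E ⊆ F → Spans X F → Spans X E
  spans-monoʳ {X} {E} {F} E⊆F X↝F = ≤-trans (r-mono M (∪-lub (p⊆p∪q F) (q⊆p∪q X F ∘ E⊆F))) X↝F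

  -- Submodularity against Y ∩ (X ∪ E), which contains X.
  spans-monoˡ : ∀ {X Y E} → X ⊆ Y → Spans X E → Spans Y E
  spans-monoˡ {X} {Y} {E} X⊆Y X↝E = +-cancelʳ-≤ (r M (Y ∩ (X ∪ E))) _ _ (begin
    r M (Y ∪ E) + r M (Y ∩ (X ∪ E))
      ≤⟨ +-monoˡ-≤ _ (r-mono M (∪-lub (p⊆p∪q (X ∪ E)) (q⊆p∪q Y (X ∪ E) ∘ q⊆p∪q X E))) ⟩
    r M (Y ∪ (X ∪ E)) + r M (Y ∩ (X ∪ E))
      ≤⟨ r-sub M Y (X ∪ E) ⟩
    r M Y + r M (X ∪ E)
      ≤⟨ +-monoʳ-≤ (r M Y) X↝E ⟩
    r M Y + r M X
      ≤⟨ +-monoʳ-≤ (r M Y) (r-mono M (λ x∈X → x∈p∩q⁺ (X⊆Y x∈X , p⊆p∪q E x∈X))) ⟩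
    r M Y + r M (Y ∩ (X ∪ E)) ∎)

  spans-∪ : ∀ {X E F} → Spans X E → Spans X F → Spans X (E ∪ F)
  spans-∪ {X} {E} {F} X↝E X↝F = begin
    r M (X ∪ (E ∪ F)) ≡⟨ cong (r M) (sym (∪-assoc X E F)) ⟩
    r M ((X ∪ E) ∪ F) ≤⟨ spans-monoˡ (p⊆p∪q E) X↝F ⟩
    r M (X ∪ E)       ≤⟨ X↝E ⟩
    r M X             ∎

  spans-pointwise : ∀ {X} E → (∀ {x} → x ∈ E → Spans X ⁅ x ⁆) → Spans X E
  spans-pointwise {X} E = go E (⊂-wellFounded E)
    where
    go : ∀ E → Acc _⊂_ E → (∀ {x} → x ∈ E → Spans X ⁅ x ⁆) → Spans X E
    go E (acc rec) X↝E with nonempty? E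
    ... | no E-empty = ⊆⇒spans (subst (_⊆ X) (sym (Empty-unique E-empty)) ⊥⊆)
    ... | yes (x , x∈E) =
      spans-monoʳ E⊆E-x∪x
        (spans-∪ (go (E - x) (rec (x∈p⇒p-x⊂p x∈E)) (X↝E ∘ p─q⊆p E ⁅ x ⁆)) (X↝E x∈E))
      where
      E⊆E-x∪x : E ⊆ (E - x) ∪ ⁅ x ⁆
      E⊆E-x∪x {y} y∈E with y F.≟ x
      ... | yes refl = q⊆p∪q (E - x) ⁅ x ⁆ (x∈⁅x⁆ x)
      ... | no y≢x = p⊆p∪q ⁅ x ⁆ (x∈p∧x≢y⇒x∈p-y y∈E y≢x)

  circuit-spanned-by-maximal-proper-subset : ∀ {C Y} → Circuit M C → Y ⊂ C → ∣ C ∣ ≤ suc ∣ Y ∣ → Spans Y C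
  circuit-spanned-by-maximal-proper-subset {C} {Y} (dependent , minimal) Y⊂C ∣C∣≤1+∣Y∣ = begin
    r M (Y ∪ C) ≤⟨ r-mono M (∪-lub (p⊂q⇒p⊆q Y⊂C) id) ⟩
    r M C       ≤⟨ ≤-pred (≤-trans dependent ∣C∣≤1+∣Y∣) ⟩
    ∣ Y ∣       ≡⟨ minimal Y Y⊂C ⟨
    r M Y       ∎

  triangle-spanned-by-two-points : ∀ {C X u v w} → Triangle M C → u ∈ C → v ∈ C → w ∈ C →
                                   u ≢ v → w ≢ u → w ≢ v → u ∈ X → v ∈ X → Spans X C
  triangle-spanned-by-two-points {C} {X} {u} {v} {w}
    (circuit , ∣C∣≡3) u∈C v∈C w∈C u≢v w≢u w≢v u∈X v∈X =
    spans-monoˡ (∪-lub (x∈p⇒⁅x⁆⊆p u∈X) (x∈p⇒⁅x⁆⊆p v∈X))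
      (circuit-spanned-by-maximal-proper-subset circuit
        (∪-lub (x∈p⇒⁅x⁆⊆p u∈C) (x∈p⇒⁅x⁆⊆p v∈C) , w , w∈C , w∉pair)
        (subst (_≤ _) (sym ∣C∣≡3) (s≤s (x∈p∧y∈p∧x≢y⇒2≤∣p∣ u∈pair v∈pair u≢v))))
    where
    u∈pair : u ∈ ⁅ u ⁆ ∪ ⁅ v ⁆
    u∈pair = p⊆p∪q ⁅ v ⁆ (x∈⁅x⁆ u)
    v∈pair : v ∈ ⁅ u ⁆ ∪ ⁅ v ⁆
    v∈pair = q⊆p∪q ⁅ u ⁆ ⁅ v ⁆ (x∈⁅x⁆ v)
    w∉pair : w ∉ ⁅ u ⁆ ∪ ⁅ v ⁆
    w∉pair w∈pair = [ w≢u ∘ x∈⁅y⁆⇒x≡y u , w≢v ∘ x∈⁅y⁆⇒x≡y v ]′ (x∈p∪q⁻ ⁅ u ⁆ ⁅ v ⁆ w∈pair)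

OnLeg : ∀ {n} → Fin n → Fin (n + n) → Set
OnLeg j x = x ≡ a j ⊎ x ≡ b j

leg-of : ∀ {n} (x : Fin (n + n)) → ∃[ j ] OnLeg j x
leg-of {n} x with splitAt n x in eq
... | inj₁ j = j , inj₁ (sym (splitAt⁻¹-↑ˡ eq))
... | inj₂ j = j , inj₂ (sym (splitAt⁻¹-↑ʳ eq))

onLeg-unique : ∀ {n} {i j : Fin n} {x} → OnLeg i x → OnLeg j x → i ≡ j
onLeg-unique {n} (inj₁ refl) (inj₁ eq) = ↑ˡ-injective n _ _ eq
onLeg-unique     (inj₁ refl) (inj₂ eq) = ⊥-elim (↑ˡ≢↑ʳ _ _ eq)
onLeg-unique     (inj₂ refl) (inj₁ eq) = ⊥-elim (↑ˡ≢↑ʳ _ _ (sym eq))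
onLeg-unique {n} (inj₂ refl) (inj₂ eq) = ↑ʳ-injective n _ _ eq

MeetsLegsOtherThan : ∀ {n} → Fin n → Subset (n + n) → Set
MeetsLegsOtherThan i X = ∀ j → j ≢ i → ∃[ x ] OnLeg j x × x ∈ X

meets-legs-mono : ∀ {n} {i : Fin n} {X Y} → X ⊆ Y → MeetsLegsOtherThan i X → MeetsLegsOtherThan i Y
meets-legs-mono X⊆Y meets j j≢i with meets j j≢i
... | x , x-on-j , x∈X = x , x-on-j , X⊆Y x∈X

transversal-meets-leg : ∀ {n T} → Transversal n T → ∀ j → ∃[ x ] OnLeg j x × x ∈ T
transversal-meets-leg tr j with tr j
... | inj₁ (a∈T , _) = a j , inj₁ refl , a∈T
... | inj₂ (_ , b∈T) = b j , inj₂ refl , b∈T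

transversal-avoids-b : ∀ {n T} → Transversal n T → ∀ j → a j ∈ T → b j ∉ T
transversal-avoids-b tr j a∈T with tr j
... | inj₁ (_ , b∉T) = b∉T
... | inj₂ (a∉T , _) = contradiction a∈T a∉T

∣transversal∣≤n : ∀ n {T} → Transversal n T → ∣ T ∣ ≤ n
∣transversal∣≤n n {T} tr with Vec.splitAt n T
... | p , q , refl = begin
  ∣ p ++ q ∣          ≡⟨ ∣p++q∣≡∣p∣+∣q∣ p q ⟩
  ∣ p ∣ + ∣ q ∣       ≤⟨ +-monoʳ-≤ ∣ p ∣ (p⊆q⇒∣p∣≤∣q∣ q⊆∁p) ⟩
  ∣ p ∣ + ∣ ∁ p ∣     ≡⟨ cong (∣ p ∣ +_) (∣∁p∣≡n∸∣p∣ p) ⟩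
  ∣ p ∣ + (n ∸ ∣ p ∣) ≡⟨ m+[n∸m]≡n (∣p∣≤n p) ⟩
  n                   ∎
  where
  open ≤-Reasoning
  q⊆∁p : q ⊆ ∁ p
  q⊆∁p {j} j∈q = x∉p⇒x∈∁p λ j∈p →
    transversal-avoids-b tr j (x∈p⇒x↑ˡ∈p++q p q j∈p) (x∈q⇒x↑ʳ∈p++q p q j∈q)

module _ {n} (j : Fin n) where

  tN∈tri : tN {n} ∈ tri j
  tN∈tri = p⊆p∪q (⁅ aN j ⁆ ∪ ⁅ bN j ⁆) (x∈⁅x⁆ (tN {n}))

  aN∈tri : aN j ∈ tri j
  aN∈tri = q⊆p∪q ⁅ tN {n} ⁆ (⁅ aN j ⁆ ∪ ⁅ bN j ⁆) (p⊆p∪q ⁅ bN j ⁆ (x∈⁅x⁆ (aN j)))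

  bN∈tri : bN j ∈ tri j
  bN∈tri = q⊆p∪q ⁅ tN {n} ⁆ (⁅ aN j ⁆ ∪ ⁅ bN j ⁆) (q⊆p∪q ⁅ aN j ⁆ ⁅ bN j ⁆ (x∈⁅x⁆ (bN j)))

  tN≢aN : tN {n} ≢ aN j
  tN≢aN ()

  tN≢bN : tN {n} ≢ bN j
  tN≢bN ()

  aN≢bN : aN j ≢ bN j
  aN≢bN = ↑ˡ≢↑ʳ j j ∘ suc-injective

∈legsUnion⇒∈tri : ∀ {n} {J : Subset n} {x} → x ∈ legsUnion J → ∃[ j ] j ∈ J × x ∈ tri j
∈legsUnion⇒∈tri {n} {J} {F.suc y} (there y∈J++J) with leg-of {n} y
... | j , inj₁ refl = j , x↑ˡ∈p++q⇒x∈p J J y∈J++J , aN∈tri j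
... | j , inj₂ refl = j , x↑ʳ∈p++q⇒x∈q J J y∈J++J , bN∈tri j

module Spike {n} {M : Matroid (n + n)} (spike : IsSpike n M) where
  open ≤-Reasoning

  t : Fin (suc (n + n))
  t = tN {n}

  N : Matroid (suc (n + n))
  N = proj₁ spike

  triangle : ∀ j → Triangle N (tri j)
  triangle = proj₁ (proj₂ (proj₂ spike))

  r-legsUnion : ∀ J → Nonempty J → J ≢ ⊤ → r N (legsUnion J) ≡ suc ∣ J ∣
  r-legsUnion = proj₁ (proj₂ (proj₂ (proj₂ spike)))

  r-deletion : ∀ X → r M X ≡ r N (outside ∷ X)
  r-deletion = proj₂ (proj₂ (proj₂ (proj₂ spike)))

  tri-spanned-via-t : ∀ {Z} (j : Fin n) {x} → OnLeg j x → t ∈ Z → F.suc x ∈ Z → Spans N Z (tri j)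
  tri-spanned-via-t j (inj₁ refl) = triangle-spanned-by-two-points N (triangle j)
    (tN∈tri j) (aN∈tri j) (bN∈tri j) (tN≢aN j) (≢-sym (tN≢bN j)) (≢-sym (aN≢bN j))
  tri-spanned-via-t j (inj₂ refl) = triangle-spanned-by-two-points N (triangle j)
    (tN∈tri j) (bN∈tri j) (aN∈tri j) (tN≢bN j) (≢-sym (tN≢aN j)) (aN≢bN j)

  tri-spanned-via-leg : ∀ {Z} (j : Fin n) → aN j ∈ Z → bN j ∈ Z → Spans N Z (tri j)
  tri-spanned-via-leg j = triangle-spanned-by-two-points N (triangle j)
    (aN∈tri j) (bN∈tri j) (tN∈tri j) (aN≢bN j) (tN≢aN j) (tN≢bN j)

  -- With t added, X spans the triangle through every leg it meets, hence all legs but l_i.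
  n≤r[X∪t] : 2 ≤ n → ∀ {i X} → MeetsLegsOtherThan i X → n ≤ r N ((outside ∷ X) ∪ ⁅ t ⁆)
  n≤r[X∪t] 2≤n {i} {X} meets = begin
    n                     ≡⟨ 1+∣∁⁅x⁆∣≡n i ⟨
    suc ∣ J ∣             ≡⟨ r-legsUnion J (∁⁅x⁆-nonempty 2≤n i) (∁⁅x⁆≢⊤ i) ⟨
    r N (legsUnion J)     ≤⟨ spans⇒r≤ N (spans-pointwise N (legsUnion J) Z↝x) ⟩
    r N Z                 ∎
    where
    J : Subset n
    J = ∁ ⁅ i ⁆
    Z : Subset (suc (n + n))
    Z = (outside ∷ X) ∪ ⁅ t ⁆
    Z↝tri : ∀ j → j ≢ i → Spans N Z (tri j)
    Z↝tri j j≢i with meets j j≢i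
    ... | x , x-on-j , x∈X = tri-spanned-via-t j x-on-j
            (q⊆p∪q (outside ∷ X) ⁅ t ⁆ (x∈⁅x⁆ t)) (p⊆p∪q {p = outside ∷ X} ⁅ t ⁆ (there x∈X))
    Z↝x : ∀ {x} → x ∈ legsUnion J → Spans N Z ⁅ x ⁆
    Z↝x x∈ with ∈legsUnion⇒∈tri {n} {J} x∈
    ... | j , j∈J , x∈tri = spans-monoʳ N (x∈p⇒⁅x⁆⊆p x∈tri)
            (Z↝tri j (x∉⁅y⁆⇒x≢y (x∈∁p⇒x∉p j∈J)))

  n≤1+r : 2 ≤ n → ∀ {i X} → MeetsLegsOtherThan i X → n ≤ suc (r M X)
  n≤1+r 2≤n {X = X} meets = begin
    n                                   ≤⟨ n≤r[X∪t] 2≤n meets ⟩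
    r N ((outside ∷ X) ∪ ⁅ t ⁆)        ≤⟨ r-∪-≤ N (outside ∷ X) ⁅ t ⁆ ⟩
    r N (outside ∷ X) + r N ⁅ t ⁆      ≤⟨ +-monoʳ-≤ _ (subst (r N ⁅ t ⁆ ≤_) (∣⁅x⁆∣≡1 t) (r-card N ⁅ t ⁆)) ⟩
    r N (outside ∷ X) + 1               ≡⟨ +-comm _ 1 ⟩
    suc (r N (outside ∷ X))             ≡⟨ cong suc (r-deletion X) ⟨
    suc (r M X)                         ∎

  -- A whole leg spans t, so adding t costs nothing.
  n≤r : 2 ≤ n → ∀ {i X} → a i ∈ X → b i ∈ X → MeetsLegsOtherThan i X → n ≤ r M X
  n≤r 2≤n {i} {X} a∈X b∈X meets = begin
    n                              ≤⟨ n≤r[X∪t] 2≤n meets ⟩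
    r N ((outside ∷ X) ∪ ⁅ t ⁆)   ≤⟨ X↝t ⟩
    r N (outside ∷ X)              ≡⟨ r-deletion X ⟨
    r M X                          ∎
    where
    X↝t : Spans N (outside ∷ X) ⁅ t ⁆
    X↝t = spans-monoʳ N (x∈p⇒⁅x⁆⊆p (tN∈tri i)) (tri-spanned-via-leg i (there a∈X) (there b∈X))

module _ {n} {T₁ T₂ : Subset (n + n)} {e} (e∈T₁─T₂ : e ∈ T₁ ─ T₂) where

  private
    e∈T₁ : e ∈ T₁
    e∈T₁ = p─q⊆p T₁ T₂ e∈T₁─T₂

    e∉T₂ : e ∉ T₂
    e∉T₂ = x∈p─q⇒x∉q T₁ T₂ e∈T₁─T₂

  -- The element of T₁ on any other leg cannot be e, so with |T₁ ─ T₂| ≤ 1 it lies in T₂.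
  transversals-share-other-legs : ∀ {i} → OnLeg i e → Transversal n T₁ → ∣ T₁ ─ T₂ ∣ ≤ 1 →
                                  MeetsLegsOtherThan i (T₁ ∩ T₂)
  transversals-share-other-legs {i} e-on-i tr₁ ∣T₁─T₂∣≤1 j j≢i with transversal-meets-leg tr₁ j
  ... | x , x-on-j , x∈T₁ with x ∈? T₂
  ...   | yes x∈T₂ = x , x-on-j , x∈p∩q⁺ (x∈T₁ , x∈T₂)
  ...   | no x∉T₂ = contradiction (onLeg-unique x-on-j (subst (OnLeg i) (sym x≡e) e-on-i)) j≢i
    where
    x≡e : x ≡ e
    x≡e = ∣p∣≤1∧x∈p∧y∈p⇒x≡y ∣T₁─T₂∣≤1 (x∈p∧x∉q⇒x∈p─q x∈T₁ x∉T₂) e∈T₁─T₂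

  transversals-cover-leg : ∀ {i} → OnLeg i e → Transversal n T₂ → a i ∈ T₁ ∪ T₂ × b i ∈ T₁ ∪ T₂
  transversals-cover-leg {i} e-on-i tr₂ with e-on-i | tr₂ i
  ... | inj₁ refl | inj₁ (a∈T₂ , _) = contradiction a∈T₂ e∉T₂
  ... | inj₁ refl | inj₂ (_ , b∈T₂) = p⊆p∪q T₂ e∈T₁ , q⊆p∪q T₁ T₂ b∈T₂
  ... | inj₂ refl | inj₁ (a∈T₂ , _) = q⊆p∪q T₁ T₂ a∈T₂ , p⊆p∪q T₂ e∈T₁
  ... | inj₂ refl | inj₂ (_ , b∈T₂) = contradiction b∈T₂ e∉T₂

lemma2p2 : (n : ℕ) → 3 ≤ n → (M : Matroid (n + n)) → IsSpike n M →
    (T₁ T₂ : Subset (n + n)) →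
    Transversal n T₁ → Dependent M T₁ →
    Transversal n T₂ → Dependent M T₂ →
    ∣ T₁ ─ T₂ ∣ ≢ 1
lemma2p2 n 3≤n M spike T₁ T₂ tr₁ T₁-dep tr₂ T₂-dep ∣T₁─T₂∣≡1
  with e , e∈T₁─T₂ ← 0<∣p∣⇒Nonempty (≤-reflexive (sym ∣T₁─T₂∣≡1))
  with i , e-on-i ← leg-of e
  = 1+n≰n (begin
    2 + (r M (T₁ ∪ T₂) + r M (T₁ ∩ T₂)) ≤⟨ dependent-∪-∩-bound M T₁-dep T₂-dep ⟩
    ∣ T₁ ∣ + ∣ T₂ ∣                     ≤⟨ +-mono-≤ (∣transversal∣≤n n tr₁) (∣transversal∣≤n n tr₂) ⟩
    n + n                               ≤⟨ +-mono-≤ (n≤r 2≤n a∈T₁∪T₂ b∈T₁∪T₂ meets∪) (n≤1+r 2≤n meets∩) ⟩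
    r M (T₁ ∪ T₂) + suc (r M (T₁ ∩ T₂)) ≡⟨ +-suc _ _ ⟩
    suc (r M (T₁ ∪ T₂) + r M (T₁ ∩ T₂)) ∎)
  where
  open ≤-Reasoning
  open Spike {n} {M} spike
  2≤n : 2 ≤ n
  2≤n = <⇒≤ 3≤n
  meets∩ : MeetsLegsOtherThan i (T₁ ∩ T₂)
  meets∩ = transversals-share-other-legs e∈T₁─T₂ e-on-i tr₁ (≤-reflexive ∣T₁─T₂∣≡1)
  meets∪ : MeetsLegsOtherThan i (T₁ ∪ T₂)
  meets∪ = meets-legs-mono (λ x∈T₁∩T₂ → p⊆p∪q T₂ (p∩q⊆p T₁ T₂ x∈T₁∩T₂)) meets∩
  a∈T₁∪T₂ : a i ∈ T₁ ∪ T₂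
  a∈T₁∪T₂ = proj₁ (transversals-cover-leg e∈T₁─T₂ e-on-i tr₂)
  b∈T₁∪T₂ : b i ∈ T₁ ∪ T₂
  b∈T₁∪T₂ = proj₂ (transversals-cover-leg e∈T₁─T₂ e-on-i tr₂)
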